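{- Suppose $P_3(\mathbf{x})=0$, where $P_3(\mathbf{x})=\sum_{i=0}^{n_{\mathcal{T}}-1}\sum_{\text{tree }v_j}\big(x_{i,j_1}x_{i,j_2}-2x_{i,j_1}z_{i,j}-2x_{i,j_2}z_{i,j}+3z_{i,j}\big)$. Let $P_7(\mathbf{x})=\sum_{i=0}^{n_{\mathcal{T}}-1}\sum_{l\ne i}f(u_i,u_l)\sum_{\text{tree }v_j}x_{i,j}z_{l,j}$. Then $P_7(\mathbf{x})=0$ if and only if there do not exist a tree vertex $v_j$ of $\mathcal{N}$ and an edge $(u_i,u_l)\in E(\mathcal{T})$ such that $v_j\in d(\mathbf{x},u_i)$ and $\{v_{j_1},v_{j_2}\}\subseteq d(\mathbf{x},u_l)$.
   Context: $\mathcal{N}$ is a rooted binary phylogenetic network on a finite set $X$ with vertices $v_0,\dots,v_{n_{\mathcal{N}}-1}$, and $\mathcal{T}$ is a rooted binary phylogenetic $X$-tree with vertices $u_0,\dots,u_{n_{\mathcal{T}}-1}$. A tree vertex has out-degree 2, and its children are $v_{j_1}$ and $v_{j_2}$ (in a fixed order). Sums over "tree $v_j$" range over indices $j$ with $v_j$ a tree vertex. $f(u_i,u_l)=1$ if $(u_i,u_l)\in E(\mathcal{T})$ and $0$ otherwise. The variables $x_{i,j}$ and $z_{i,j}$ are binary, and $\mathbf{x}$ is the vector of them. $d(\mathbf{x},u_i)=\{v_j:x_{i,j}=1\}$. -}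

module Defs where

open import Data.Nat using (ℕ; zero; suc; _≤_; _+_)
open import Data.Bool using (Bool; true; false; if_then_else_)
open import Data.Fin using (Fin; zero; suc)
open import Data.Fin.Properties using () renaming (_≟_ to _≟ᶠ_)
open import Data.Integer using (ℤ; _-_; _*_) renaming (_+_ to _+ℤ_; 0ℤ to zeroℤ)
import Data.Integer as ℤ
open import Data.Product using (Σ; _×_; ∃)
open import Data.Sum using (_⊎_)
open import Relation.Nullary using (¬_; does)
open import Relation.Binary.PropositionalEquality using (_≡_; _≢_)
open import Function using (_∘_)
open import Function.Definitions using (Injective)

count : ∀ {n} → (Fin n → Bool) → ℕ
count {zero}  p = 0
count {suc n} p = (if p zero then 1 else 0) + count (p ∘ suc)

sumℤ : ∀ {n} → (Fin n → ℤ) → ℤ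
sumℤ {zero}  f = zeroℤ
sumℤ {suc n} f = f zero +ℤ sumℤ (f ∘ suc)

⟦_⟧ : Bool → ℤ
⟦ true ⟧  = ℤ.+ 1
⟦ false ⟧ = ℤ.+ 0

module Digraph {n : ℕ} (E : Fin n → Fin n → Bool) where

  outdeg : Fin n → ℕ
  outdeg v = count (E v)

  indeg : Fin n → ℕ
  indeg v = count (λ u → E u v)

  data Path : Fin n → Fin n → Set where
    edge : ∀ {u v} → E u v ≡ true → Path u v
    step : ∀ {u v w} → E u v ≡ true → Path v w → Path u w

  Acyclic : Set
  Acyclic = ∀ v → ¬ Path v v

-- Rooted binary phylogenetic network on X = Fin k.

record PhyloNetwork (k : ℕ) : Set where
  field
    n       : ℕ
    E       : Fin n → Fin n → Bool
  open Digraph E public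
  field
    acyclic     : Acyclic
    root        : Fin n
    root-indeg  : indeg root ≡ 0
    root-unique : ∀ v → indeg v ≡ 0 → v ≡ root
    root-outdeg : outdeg root ≤ 2
    nonroot     : ∀ v → v ≢ root →
                    (indeg v ≡ 1 × outdeg v ≡ 2)
                  ⊎ (indeg v ≡ 2 × outdeg v ≡ 1)
                  ⊎ (indeg v ≡ 1 × outdeg v ≡ 0)
    label       : Fin k → Fin n
    label-inj   : Injective _≡_ _≡_ label
    label-leaf  : ∀ x → outdeg (label x) ≡ 0
    leaf-label  : ∀ v → outdeg v ≡ 0 → ∃ λ x → label x ≡ v

record PhyloTree (k : ℕ) : Set where
  field
    net      : PhyloNetwork k
  open PhyloNetwork net public
  field
    no-retic : ∀ v → indeg v ≤ 1

module Setting {k : ℕ} (N : PhyloNetwork k) (T : PhyloTree k) where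
  module N = PhyloNetwork N
  module T = PhyloTree T

  nN = N.n
  nT = T.n

  TreeVertex : Fin nN → Set
  TreeVertex j = N.outdeg j ≡ 2

  isTree : Fin nN → Bool
  isTree j = does (N.outdeg j Data.Nat.≟ 2)
    where import Data.Nat

  -- a fixed ordering (j₁ , j₂) of the two children of each tree vertex
  record ChildOrder : Set where
    field
      c₁ c₂ : Fin nN → Fin nN
      spec  : ∀ j → TreeVertex j →
                N.E j (c₁ j) ≡ true × N.E j (c₂ j) ≡ true × c₁ j ≢ c₂ j

  sumTree : (Fin nN → ℤ) → ℤ
  sumTree g = sumℤ (λ j → if isTree j then g j else zeroℤ)

  f : Fin nT → Fin nT → ℤ
  f i l = ⟦ T.E i l ⟧

  Vars : Set
  Vars = Fin nT → Fin nN → Bool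

  d : Vars → Fin nT → Fin nN → Set
  d x i v = x i v ≡ true

  module _ (ch : ChildOrder) (x z : Vars) where
    open ChildOrder ch

    P₃ : ℤ
    P₃ = sumℤ λ i → sumTree λ j →
           ((⟦ x i (c₁ j) ⟧ * ⟦ x i (c₂ j) ⟧
             - ℤ.+ 2 * ⟦ x i (c₁ j) ⟧ * ⟦ z i j ⟧)
             - ℤ.+ 2 * ⟦ x i (c₂ j) ⟧ * ⟦ z i j ⟧)
             +ℤ ℤ.+ 3 * ⟦ z i j ⟧

    P₇ : ℤ
    P₇ = sumℤ λ i → sumℤ λ l →
           if does (i ≟ᶠ l) then zeroℤ
           else f i l * sumTree (λ j → ⟦ x i j ⟧ * ⟦ z l j ⟧)

-- Both P₃ and P₇ are sums of nonnegative terms, so each vanishes exactly when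
-- all its terms do. A summand of P₃ vanishes iff z_{i,j} = x_{i,j₁} ∧ x_{i,j₂}, so
-- under P₃ = 0 the product x_{i,j} z_{l,j} in P₇ is 1 exactly at a forbidden
-- configuration; the restriction l ≠ i in P₇ is harmless because a tree has no loops.
module Submission where

open import Defs
open import Data.Nat using (ℕ; zero; suc; z≤n)
import Data.Nat as ℕ
import Data.Nat.Properties as ℕP
open import Data.Bool using (Bool; true; false; _∧_; if_then_else_)
open import Data.Fin using (Fin; zero; suc)
open import Data.Fin.Properties using () renaming (_≟_ to _≟ᶠ_)
open import Data.Integer using (ℤ; 0ℤ; +_; _≤_; +≤+; _*_; _-_) renaming (_+_ to _+ℤ_)
import Data.Integer.Properties as ℤP
open import Data.Product using (∃; _×_; _,_; proj₁; proj₂)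
open import Relation.Nullary using (¬_; does; yes; no; contradiction)
open import Relation.Nullary.Decidable using (dec-true; dec-false)
open import Relation.Binary.PropositionalEquality using (_≡_; _≢_; refl; cong)
open import Function using (_∘_)
open import Function.Bundles using (_⇔_; mk⇔; Equivalence)
open Equivalence using (to; from)

+-nonneg≡0⇔ : ∀ {a b} → 0ℤ ≤ a → 0ℤ ≤ b → a +ℤ b ≡ 0ℤ ⇔ (a ≡ 0ℤ × b ≡ 0ℤ)
+-nonneg≡0⇔ (+≤+ {n = m} _) (+≤+ _) = mk⇔
  (λ eq → cong +_ (ℕP.m+n≡0⇒m≡0 m (ℤP.+-injective eq))
        , cong +_ (ℕP.m+n≡0⇒n≡0 m (ℤP.+-injective eq)))
  (λ { (refl , refl) → refl })

sumℤ-nonneg : ∀ {n} {f : Fin n → ℤ} → (∀ i → 0ℤ ≤ f i) → 0ℤ ≤ sumℤ f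
sumℤ-nonneg {zero}  _   = ℤP.≤-refl
sumℤ-nonneg {suc n} f≥0 = ℤP.+-mono-≤ (f≥0 zero) (sumℤ-nonneg (f≥0 ∘ suc))

sumℤ≡0⇔ : ∀ {n} {f : Fin n → ℤ} → (∀ i → 0ℤ ≤ f i) → sumℤ f ≡ 0ℤ ⇔ (∀ i → f i ≡ 0ℤ)
sumℤ≡0⇔ {zero}  _   = mk⇔ (λ _ ()) (λ _ → refl)
sumℤ≡0⇔ {suc n} f≥0 = mk⇔
  (λ { eq zero → proj₁ (to split eq) ; eq (suc i) → to tail (proj₂ (to split eq)) i })
  (λ f≡0 → from split (f≡0 zero , from tail (f≡0 ∘ suc)))
  where
  tail  = sumℤ≡0⇔ (f≥0 ∘ suc)
  split = +-nonneg≡0⇔ (f≥0 zero) (sumℤ-nonneg (f≥0 ∘ suc))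

sumℤ²≡0⇔ : ∀ {m n} {g : Fin m → Fin n → ℤ} → (∀ i l → 0ℤ ≤ g i l) →
           sumℤ (λ i → sumℤ (g i)) ≡ 0ℤ ⇔ (∀ i l → g i l ≡ 0ℤ)
sumℤ²≡0⇔ g≥0 = mk⇔
  (λ eq i → to (rows i) (to outer eq i))
  (λ g≡0 → from outer (λ i → from (rows i) (g≡0 i)))
  where
  rows  = λ i → sumℤ≡0⇔ (g≥0 i)
  outer = sumℤ≡0⇔ (λ i → sumℤ-nonneg (g≥0 i))

⟦⟧-nonneg : ∀ b → 0ℤ ≤ ⟦ b ⟧
⟦⟧-nonneg true  = +≤+ z≤n
⟦⟧-nonneg false = +≤+ z≤n

⟦⟧*-nonneg : ∀ b {s} → 0ℤ ≤ s → 0ℤ ≤ ⟦ b ⟧ * s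
⟦⟧*-nonneg true  {s} s≥0 rewrite ℤP.*-identityˡ s = s≥0
⟦⟧*-nonneg false     _   = ℤP.≤-refl

⟦⟧*≡0⇔ : ∀ b {s} → ⟦ b ⟧ * s ≡ 0ℤ ⇔ (b ≡ true → s ≡ 0ℤ)
⟦⟧*≡0⇔ true  {s} rewrite ℤP.*-identityˡ s = mk⇔ (λ s≡0 _ → s≡0) (λ h → h refl)
⟦⟧*≡0⇔ false     = mk⇔ (λ _ ()) (λ _ → refl)

⟦⟧*⟦∧⟧≡0⇔ : ∀ a b c → ⟦ a ⟧ * ⟦ b ∧ c ⟧ ≡ 0ℤ ⇔ (¬ (a ≡ true × b ≡ true × c ≡ true))
⟦⟧*⟦∧⟧≡0⇔ true  true  true  = mk⇔ (λ ()) (λ h → contradiction (refl , refl , refl) h)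
⟦⟧*⟦∧⟧≡0⇔ true  true  false = mk⇔ (λ { _ (_ , _ , ()) }) (λ _ → refl)
⟦⟧*⟦∧⟧≡0⇔ true  false _     = mk⇔ (λ { _ (_ , () , _) }) (λ _ → refl)
⟦⟧*⟦∧⟧≡0⇔ false _     _     = mk⇔ (λ { _ (() , _) }) (λ _ → refl)

-- The summand of P₃, as a linearisation of the constraint c = a ∧ b.
and-penalty : Bool → Bool → Bool → ℤ
and-penalty a b c =
  ((⟦ a ⟧ * ⟦ b ⟧ - + 2 * ⟦ a ⟧ * ⟦ c ⟧) - + 2 * ⟦ b ⟧ * ⟦ c ⟧) +ℤ + 3 * ⟦ c ⟧

and-penalty-nonneg : ∀ a b c → 0ℤ ≤ and-penalty a b c
and-penalty-nonneg true  true  true  = +≤+ z≤n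
and-penalty-nonneg true  true  false = +≤+ z≤n
and-penalty-nonneg true  false true  = +≤+ z≤n
and-penalty-nonneg true  false false = +≤+ z≤n
and-penalty-nonneg false true  true  = +≤+ z≤n
and-penalty-nonneg false true  false = +≤+ z≤n
and-penalty-nonneg false false true  = +≤+ z≤n
and-penalty-nonneg false false false = +≤+ z≤n

and-penalty≡0⇒ : ∀ a b c → and-penalty a b c ≡ 0ℤ → c ≡ a ∧ b
and-penalty≡0⇒ true  true  true  _  = refl
and-penalty≡0⇒ true  true  false ()
and-penalty≡0⇒ true  false true  ()
and-penalty≡0⇒ true  false false _  = refl
and-penalty≡0⇒ false true  true  ()
and-penalty≡0⇒ false true  false _  = refl
and-penalty≡0⇒ false false true  ()
and-penalty≡0⇒ false false false _  = refl

module _ {k : ℕ} (N : PhyloNetwork k) (T : PhyloTree k) where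
  open Setting N T

  T-loop-free : ∀ i → T.E i i ≢ true
  T-loop-free i loop = T.acyclic i (T.edge loop)

  if-isTree-nonneg : ∀ {g : Fin nN → ℤ} → (∀ j → 0ℤ ≤ g j) → ∀ j → 0ℤ ≤ (if isTree j then g j else 0ℤ)
  if-isTree-nonneg g≥0 j with isTree j
  ... | true  = g≥0 j
  ... | false = ℤP.≤-refl

  if-isTree≡0⇔ : ∀ j {a} → (if isTree j then a else 0ℤ) ≡ 0ℤ ⇔ (TreeVertex j → a ≡ 0ℤ)
  if-isTree≡0⇔ j with N.outdeg j ℕ.≟ 2
  ... | yes tv rewrite dec-true  (N.outdeg j ℕ.≟ 2) tv  = mk⇔ (λ a≡0 _ → a≡0) (λ h → h tv)
  ... | no ¬tv rewrite dec-false (N.outdeg j ℕ.≟ 2) ¬tv = mk⇔ (λ _ tv → contradiction tv ¬tv) (λ _ → refl)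

  sumTree-nonneg : ∀ {g : Fin nN → ℤ} → (∀ j → 0ℤ ≤ g j) → 0ℤ ≤ sumTree g
  sumTree-nonneg = sumℤ-nonneg ∘ if-isTree-nonneg

  sumTree≡0⇔ : ∀ {g : Fin nN → ℤ} → (∀ j → 0ℤ ≤ g j) → sumTree g ≡ 0ℤ ⇔ (∀ j → TreeVertex j → g j ≡ 0ℤ)
  sumTree≡0⇔ g≥0 = mk⇔
    (λ eq j → to (if-isTree≡0⇔ j) (to terms eq j))
    (λ h → from terms (λ j → from (if-isTree≡0⇔ j) (h j)))
    where terms = sumℤ≡0⇔ (if-isTree-nonneg g≥0)

  module _ (ch : ChildOrder) (x z : Vars) where
    open ChildOrder ch

    z-is-and : P₃ ch x z ≡ 0ℤ → ∀ l j → TreeVertex j → z l j ≡ x l (c₁ j) ∧ x l (c₂ j)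
    z-is-and P₃≡0 l j tv = and-penalty≡0⇒ (x l (c₁ j)) (x l (c₂ j)) (z l j)
      (to (sumTree≡0⇔ (penalty-nonneg l)) (to rows P₃≡0 l) j tv)
      where
      penalty-nonneg : ∀ i j → 0ℤ ≤ and-penalty (x i (c₁ j)) (x i (c₂ j)) (z i j)
      penalty-nonneg i j = and-penalty-nonneg (x i (c₁ j)) (x i (c₂ j)) (z i j)
      rows = sumℤ≡0⇔ (sumTree-nonneg ∘ penalty-nonneg)

    Violation : Fin nN → Fin nT → Fin nT → Set
    Violation j i l = TreeVertex j × T.E i l ≡ true × d x i j × d x l (c₁ j) × d x l (c₂ j)

    P₇-term : Fin nT → Fin nT → ℤ
    P₇-term i l = if does (i ≟ᶠ l) then 0ℤ else f i l * sumTree (λ j → ⟦ x i j ⟧ * ⟦ z l j ⟧)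

    x*z-nonneg : ∀ i l j → 0ℤ ≤ ⟦ x i j ⟧ * ⟦ z l j ⟧
    x*z-nonneg i l j = ⟦⟧*-nonneg (x i j) (⟦⟧-nonneg (z l j))

    P₇-term-nonneg : ∀ i l → 0ℤ ≤ P₇-term i l
    P₇-term-nonneg i l with does (i ≟ᶠ l)
    ... | true  = ℤP.≤-refl
    ... | false = ⟦⟧*-nonneg (T.E i l) (sumTree-nonneg (x*z-nonneg i l))

    P₇≡0⇔ : P₇ ch x z ≡ 0ℤ ⇔ (∀ i l → P₇-term i l ≡ 0ℤ)
    P₇≡0⇔ = sumℤ²≡0⇔ P₇-term-nonneg

    module _ (P₃≡0 : P₃ ch x z ≡ 0ℤ) where

      x*z≡0⇔ : ∀ {i l j} → TreeVertex j →
               ⟦ x i j ⟧ * ⟦ z l j ⟧ ≡ 0ℤ ⇔ (¬ (d x i j × d x l (c₁ j) × d x l (c₂ j)))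
      x*z≡0⇔ {i} {l} {j} tv rewrite z-is-and P₃≡0 l j tv = ⟦⟧*⟦∧⟧≡0⇔ (x i j) _ _

      P₇-term≡0⇔ : ∀ i l → P₇-term i l ≡ 0ℤ ⇔ (∀ j → ¬ Violation j i l)
      P₇-term≡0⇔ i l with i ≟ᶠ l
      ... | yes refl = mk⇔ (λ _ j (_ , loop , _) → T-loop-free i loop) (λ _ → refl)
      ... | no _     = mk⇔
        (λ t≡0 j (tv , e , v) → to (x*z≡0⇔ tv) (to inner (to (⟦⟧*≡0⇔ (T.E i l)) t≡0 e) j tv) v)
        (λ h → from (⟦⟧*≡0⇔ (T.E i l)) λ e → from inner λ j tv → from (x*z≡0⇔ tv) λ v → h j (tv , e , v))
        where inner = sumTree≡0⇔ (x*z-nonneg i l)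

lemma9 : {k : ℕ} (N : PhyloNetwork k) (T : PhyloTree k)
    (ch : Setting.ChildOrder N T)
    (x z : Setting.Vars N T) →
    Setting.P₃ N T ch x z ≡ 0ℤ →
    (Setting.P₇ N T ch x z ≡ 0ℤ
    ⇔ (¬ ∃ λ (j : Fin (PhyloNetwork.n N)) → ∃ λ (i : Fin (PhyloTree.n T)) → ∃ λ (l : Fin (PhyloTree.n T)) →
    Setting.TreeVertex N T j
    × PhyloTree.E T i l ≡ true
    × Setting.d N T x i j
    × Setting.d N T x l (Setting.ChildOrder.c₁ ch j)
    × Setting.d N T x l (Setting.ChildOrder.c₂ ch j)))
lemma9 N T ch x z P₃≡0 = mk⇔
  (λ P₇≡0 (j , i , l , v) → to (term≡0⇔ i l) (to P₇≡0⇔terms P₇≡0 i l) j v)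
  (λ noViolation → from P₇≡0⇔terms λ i l → from (term≡0⇔ i l) λ j v → noViolation (j , i , l , v))
  where
  P₇≡0⇔terms = P₇≡0⇔ N T ch x z
  term≡0⇔    = P₇-term≡0⇔ N T ch x z P₃≡0
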